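{- For any positive integers $r\le d$ and any positive integer $s$, $$N_{d,r}(s)=\sum_{\mu=0}^{\left\lceil \frac{s-1}{d+1}\right\rceil}\binom{s+d-d\mu-1}{\mu}+(r-1)\sum_{\mu=0}^{\left\lceil \frac{s-2d-1}{d+1}\right\rceil}\binom{s-d-d\mu-1}{\mu}.$$
   Context: A partition $\lambda=(\lambda_1,\dots,\lambda_k)$ is a finite nonincreasing sequence of positive integers (the empty partition is allowed). In its Young diagram (row $i$ has $\lambda_i$ left-justified cells), the hook length $h(i,j)$ of cell $(i,j)$ is $1$ plus the number of cells to its right in its row plus the number of cells below it in its column. For a positive integer $t$, $\lambda$ is $t$-core if no cell has hook length $t$; it is $(s,s+r)$-core if it is both $s$-core and $(s+r)$-core. $\lambda$ has $d$-distinct parts if $\lambda_i-\lambda_{i+1}\ge d$ for all $1\le i\le k-1$. For positive integers $d,r,s$, $N_{d,r}(s)$ is the number of $(s,s+r)$-core partitions with $d$-distinct parts. $\lceil x\rceil$ is the least integer $\ge x$. A sum whose upper limit is less than its lower limit equals $0$, and $\binom{n}{k}=0$ when $k>n\ge 0$. -}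

module Defs where

open import Data.Nat as ℕ using (ℕ; zero; suc; _+_; _*_; _∸_; _≤_; _<_; _<?_; NonZero)
open import Data.Nat.Combinatorics using (_C_)
open import Data.Integer as ℤ using (ℤ; +_; -[1+_]; _/ℕ_)
open import Data.Fin using (Fin)
open import Data.List using (List; []; _∷_; length; lookup; drop; filter; map; upTo)
open import Data.Nat.ListAction using (sum)
open import Data.List.Relation.Unary.All using (All)
open import Data.List.Relation.Unary.Linked using (Linked)
open import Data.List.Relation.Unary.Unique.Propositional using (Unique)
open import Data.List.Membership.Propositional using (_∈_)
open import Data.Product using (Σ; _×_)
open import Function.Bundles using (_⇔_)
open import Relation.Binary.PropositionalEquality using (_≡_; _≢_)

IsPartition : List ℕ → Set
IsPartition λ′ = All (λ a → 0 < a) λ′ × Linked (λ a b → b ≤ a) λ′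

-- Cells are (i , j) with i : Fin (length λ) (0-based row) and j < λ_i (0-based column).
-- leg length: number of rows strictly below row i whose length exceeds j.
leg : (λ′ : List ℕ) → Fin (length λ′) → ℕ → ℕ
leg λ′ i j = length (filter (j <?_) (drop (suc (Data.Fin.toℕ i)) λ′))

arm : (λ′ : List ℕ) → Fin (length λ′) → ℕ → ℕ
arm λ′ i j = lookup λ′ i ∸ suc j

hook : (λ′ : List ℕ) → Fin (length λ′) → ℕ → ℕ
hook λ′ i j = 1 + arm λ′ i j + leg λ′ i j

IsCore : ℕ → List ℕ → Set
IsCore t λ′ = (i : Fin (length λ′)) (j : ℕ) → j < lookup λ′ i → hook λ′ i j ≢ t

DDistinct : ℕ → List ℕ → Set
DDistinct d λ′ = Linked (λ a b → d + b ≤ a) λ′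

Counted : ℕ → ℕ → ℕ → List ℕ → Set
Counted d r s λ′ = IsPartition λ′ × IsCore s λ′ × IsCore (s + r) λ′ × DDistinct d λ′

-- "the number of λ with P λ is n": there is a duplicate-free list of exactly those λ, of length n.
HasCount : (List ℕ → Set) → ℕ → Set
HasCount P n = Σ (List (List ℕ)) (λ L → Unique L × ((λ′ : List ℕ) → (λ′ ∈ L) ⇔ P λ′) × length L ≡ n)

ceilDiv : ℤ → (b : ℕ) → .{{NonZero b}} → ℤ
ceilDiv a b = ℤ.- ((ℤ.- a) /ℕ b)

-- Σ_{μ=0}^{U} f μ, which is 0 when U < 0
sumTo : ℤ → (ℕ → ℕ) → ℕ
sumTo (+ n)    f = sum (map f (upTo (suc n)))
sumTo -[1+ _ ] f = 0

-- binomial coefficient with an integer top entry (negative top never occurs below; set to 0)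
Cℤ : ℤ → ℕ → ℕ
Cℤ (+ n)    k = n C k
Cℤ -[1+ _ ] k = 0

formula : ℕ → ℕ → ℕ → ℕ
formula d r s =
  sumTo (ceilDiv (+ s ℤ.- + 1) (suc d)) (λ μ → Cℤ (+ s ℤ.+ + d ℤ.- + (d * μ) ℤ.- + 1) μ)
  + (r ∸ 1) * sumTo (ceilDiv (+ s ℤ.- + (2 * d) ℤ.- + 1) (suc d)) (λ μ → Cℤ (+ s ℤ.- + d ℤ.- + (d * μ) ℤ.- + 1) μ)

-- Let λ be a d-distinct partition and r ≤ d. Along the first row, consecutive hook lengths drop
-- by 1, or by 2 on entering a column b that equals a part below the first row; so every value
-- up to the corner hook λ₁ + ℓ - 1 that is not a first-row hook lies just above the hook at such
-- a column b. Two such values s and s + r (1 ≤ r ≤ d) cannot both occur, because parts differ by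
-- at least d. Hence λ is an (s, s + r)-core iff either its corner hook is below s, or it equals
-- s + c where c < r is the last part of λ.
--
-- Partitions of the first kind with k parts are the d-distinct lists with parts ≥ 1 and
-- λ₁ + ℓ ≤ s. Removing the first and last parts of one of the second kind leaves a d-distinct
-- list with parts ≥ c + d, which determines it. Both families are counted by splitting on
-- whether the bound on λ₁ + ℓ is attained, which gives the recurrence
-- f(n + 1, k + 1) = f(n, k + 1) + f(n - d, k) solved by binomial coefficients; the upper
-- limits of the sums in the formula are where these coefficients vanish.

module Submission where

open import Defs
open import Data.Nat using (ℕ; zero; suc; _+_; _*_; _∸_; _≤_; _<_; _≤?_; _<?_; _≟_; z≤n; s≤s; z<s; NonZero)
open import Data.Nat.Properties
open import Data.Nat.Combinatorics using (_C_; nCk+nC[k+1]≡[n+1]C[k+1]; k>n⇒nCk≡0)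
open import Data.Nat.ListAction using (sum)
open import Data.Nat.ListAction.Properties using (sum-++)
open import Data.Nat.Tactic.RingSolver using (solve-∀)
open import Data.Integer as ℤ using (ℤ; +_; -[1+_]; _/ℕ_; _⊖_)
import Data.Integer.Properties as ℤ
open import Data.Integer.DivMod using ([n/ℕd]*d≤n)
import Data.Integer.Tactic.RingSolver as ℤ-Solver
open import Data.Fin using (Fin; zero; suc)
open import Data.List using (List; []; _∷_; _++_; [_]; length; lookup; filter; map; upTo)
open import Data.List.Properties
  using (length-++; length-map; map-++; upTo-∷ʳ; filter-accept; filter-reject; filter-++;
         ∷-injectiveʳ; ∷ʳ-injectiveˡ; ∷ʳ-injectiveʳ)
open import Data.List.Membership.Propositional using (_∈_)
open import Data.List.Membership.Propositional.Properties using (∈-++⁺ˡ; ∈-++⁺ʳ; ∈-++⁻; ∈-map⁺; ∈-map⁻)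
open import Data.List.Relation.Unary.All as All using (All; []; _∷_)
open import Data.List.Relation.Unary.AllPairs as AllPairs using (AllPairs; []; _∷_)
open import Data.List.Relation.Unary.Any using (here; there)
open import Data.List.Relation.Unary.Linked as Linked using (Linked; []; [-]; _∷_)
open import Data.List.Relation.Unary.Linked.Properties using (Linked⇒AllPairs)
import Data.List.Relation.Unary.Unique.Propositional.Properties as Unique
open import Data.Product using (Σ; _×_; _,_; proj₁; proj₂)
open import Data.Sum as Sum using (_⊎_; inj₁; inj₂)
open import Data.Empty using (⊥; ⊥-elim)
open import Function using (_∘′_; case_of_)
open import Function.Bundles using (_⇔_; mk⇔; Equivalence)
open import Relation.Binary.PropositionalEquality
  using (_≡_; _≢_; refl; sym; trans; cong; cong₂; subst; subst₂; module ≡-Reasoning)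
open import Relation.Nullary using (yes; no; ¬_)

open Equivalence

private
  variable
    P Q : List ℕ → Set
    i j m n v x : ℕ

HasCount-resp : (∀ x → P x ⇔ Q x) → HasCount P n → HasCount Q n
HasCount-resp P⇔Q (L , unique , mem , len) =
  L , unique , (λ x → mk⇔ (to (P⇔Q x) ∘′ to (mem x)) (from (mem x) ∘′ from (P⇔Q x))) , len

HasCount-∅ : (∀ x → ¬ P x) → HasCount P 0
HasCount-∅ ¬P = [] , [] , (λ x → mk⇔ (λ ()) (λ p → ⊥-elim (¬P x p))) , refl

HasCount-singleton : ∀ y → HasCount (_≡ y) 1
HasCount-singleton y =
  [ y ] , [] ∷ [] , (λ x → mk⇔ (λ { (here x≡y) → x≡y ; (there ()) }) (λ x≡y → here x≡y)) , refl

HasCount⇒≢0 : ∀ {x} → HasCount P n → P x → n ≢ 0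
HasCount⇒≢0         (_ ∷ _ , _ , _ , refl) _ ()
HasCount⇒≢0 {x = x} ([] , _ , mem , _)     p _ with from (mem x) p
... | ()

HasCount-⊎ : (∀ {x} → P x → Q x → ⊥) → HasCount P m → HasCount Q n →
             HasCount (λ x → P x ⊎ Q x) (m + n)
HasCount-⊎ {P = P} {Q = Q} disjoint (L , uL , memL , lenL) (M , uM , memM , lenM) =
  L ++ M , Unique.++⁺ uL uM (λ (x∈L , x∈M) → disjoint (to (memL _) x∈L) (to (memM _) x∈M)) ,
  mem , trans (length-++ L) (cong₂ _+_ lenL lenM)
  where
  mem : ∀ x → x ∈ L ++ M ⇔ (P x ⊎ Q x)
  mem x = mk⇔ (λ x∈ → Sum.map (to (memL x)) (to (memM x)) (∈-++⁻ L x∈))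
              (Sum.[ (λ p → ∈-++⁺ˡ (from (memL x) p)) , (λ q → ∈-++⁺ʳ L (from (memM x) q)) ])

HasCount-image : (f : List ℕ → List ℕ) → (∀ {x y} → f x ≡ f y → x ≡ y) → HasCount P n →
                 HasCount (λ y → Σ (List ℕ) λ x → P x × y ≡ f x) n
HasCount-image {P = P} f f-injective (L , uL , memL , lenL) =
  map f L , Unique.map⁺ f-injective uL , mem , trans (length-map f L) lenL
  where
  mem : ∀ y → y ∈ map f L ⇔ Σ (List ℕ) λ x → P x × y ≡ f x
  mem y = mk⇔ (λ y∈ → let (x , x∈ , y≡fx) = ∈-map⁻ f y∈ in x , to (memL x) x∈ , y≡fx)
              (λ { (x , p , refl) → ∈-map⁺ f (from (memL x) p) })

sum-map-upTo-suc : (f : ℕ → ℕ) (n : ℕ) → sum (map f (upTo (suc n))) ≡ sum (map f (upTo n)) + f n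
sum-map-upTo-suc f n = begin
  sum (map f (upTo (suc n)))            ≡⟨ cong (sum ∘′ map f) (sym (upTo-∷ʳ n)) ⟩
  sum (map f (upTo n ++ [ n ]))         ≡⟨ cong sum (map-++ f (upTo n) [ n ]) ⟩
  sum (map f (upTo n) ++ [ f n ])       ≡⟨ sum-++ (map f (upTo n)) [ f n ] ⟩
  sum (map f (upTo n)) + (f n + 0)      ≡⟨ cong (λ z → sum (map f (upTo n)) + z) (+-identityʳ (f n)) ⟩
  sum (map f (upTo n)) + f n            ∎
  where open ≡-Reasoning

sum-map-const-upTo : ∀ x n → sum (map (λ _ → x) (upTo n)) ≡ n * x
sum-map-const-upTo x zero    = refl
sum-map-const-upTo x (suc n) = begin
  sum (map (λ _ → x) (upTo (suc n))) ≡⟨ sum-map-upTo-suc (λ _ → x) n ⟩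
  sum (map (λ _ → x) (upTo n)) + x   ≡⟨ cong (_+ x) (sum-map-const-upTo x n) ⟩
  n * x + x                          ≡⟨ +-comm (n * x) x ⟩
  suc n * x                          ∎
  where open ≡-Reasoning

module _ {P : ℕ → List ℕ → Set} {f : ℕ → ℕ}
         (count : ∀ i → HasCount (P i) (f i))
         (index-unique : ∀ {i j x} → P i x → P j x → i ≡ j) where

  HasCount-Σ< : ∀ n → HasCount (λ x → Σ ℕ λ i → i < n × P i x) (sum (map f (upTo n)))
  HasCount-Σ< zero    = HasCount-∅ (λ { _ (_ , () , _) })
  HasCount-Σ< (suc n) =
    subst (HasCount _) (sym (sum-map-upTo-suc f n))
      (HasCount-resp split (HasCount-⊎ disjoint (HasCount-Σ< n) (count n)))
    where
    disjoint : ∀ {x} → (Σ ℕ λ i → i < n × P i x) → P n x → ⊥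
    disjoint (i , i<n , p) q = <-irrefl (index-unique p q) i<n
    split : ∀ x → ((Σ ℕ λ i → i < n × P i x) ⊎ P n x) ⇔ (Σ ℕ λ i → i < suc n × P i x)
    split x = mk⇔ (Sum.[ (λ (i , i<n , p) → i , m<n⇒m<1+n i<n , p) , (λ p → n , ≤-refl , p) ])
                  (λ (i , i<1+n , p) → Sum.map (λ i<n → i , i<n , p) (λ { refl → p }) (m<1+n⇒m<n∨m≡n i<1+n))

  HasCount-sumTo : (U : ℤ) → (∀ {k x} → P k x → + k ℤ.≤ U) →
                   HasCount (λ x → Σ ℕ λ k → P k x) (sumTo U f)
  HasCount-sumTo (+ u) bounded = HasCount-resp drop-bound (HasCount-Σ< (suc u))
    where
    drop-bound : ∀ x → (Σ ℕ λ k → k < suc u × P k x) ⇔ (Σ ℕ λ k → P k x)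
    drop-bound x = mk⇔ (λ (k , _ , p) → k , p) (λ (k , p) → k , s≤s (ℤ.drop‿+≤+ (bounded p)) , p)
  HasCount-sumTo -[1+ _ ] bounded = HasCount-∅ (λ { _ (_ , p) → case bounded p of λ () })

x+e≤m+n⇒x≤m+[n∸e] : ∀ {x e m n} → x + e ≤ m + n → x ≤ m + (n ∸ e)
x+e≤m+n⇒x≤m+[n∸e] {x} {e} {m} {n} x+e≤m+n = +-cancelʳ-≤ e x (m + (n ∸ e)) (begin
  x + e             ≤⟨ x+e≤m+n ⟩
  m + n             ≤⟨ +-monoʳ-≤ m (m≤n+m∸n n e) ⟩
  m + (e + (n ∸ e)) ≡⟨ cong (_+_ m) (+-comm e (n ∸ e)) ⟩
  m + (n ∸ e + e)   ≡⟨ +-assoc m (n ∸ e) e ⟨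
  m + (n ∸ e) + e   ∎)
  where open ≤-Reasoning

m<x≤m+[n∸e]⇒x+e≤m+n : ∀ {x e m n} → m < x → x ≤ m + (n ∸ e) → x + e ≤ m + n
m<x≤m+[n∸e]⇒x+e≤m+n {x} {e} {m} {n} m<x x≤ with e ≤? n
... | yes e≤n = begin
  x + e           ≤⟨ +-monoˡ-≤ e x≤ ⟩
  m + (n ∸ e) + e ≡⟨ +-assoc m (n ∸ e) e ⟩
  m + (n ∸ e + e) ≡⟨ cong (_+_ m) (m∸n+n≡m e≤n) ⟩
  m + n           ∎
  where open ≤-Reasoning
... | no e≰n = ⊥-elim (<-irrefl refl (<-≤-trans m<x (≤-trans x≤ (≤-reflexive
                 (trans (cong (_+_ m) (m≤n⇒m∸n≡0 (<⇒≤ (≰⇒> e≰n)))) (+-identityʳ m))))))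

-- d-distinct lists

Nonincreasing : List ℕ → Set
Nonincreasing = Linked (λ x y → y ≤ x)

Decreasing : List ℕ → Set
Decreasing = AllPairs (λ x y → y < x)

module _ {d : ℕ} where

  DDistinct⇒AllPairs : ∀ {μ} → DDistinct d μ → AllPairs (λ x y → d + y ≤ x) μ
  DDistinct⇒AllPairs = Linked⇒AllPairs (λ {_} {y} x≥d+y y≥d+z → ≤-trans y≥d+z (≤-trans (m≤n+m y d) x≥d+y))

  DDistinct⇒nonincreasing : ∀ {μ} → DDistinct d μ → Nonincreasing μ
  DDistinct⇒nonincreasing = Linked.map (λ {x} {y} x≥d+y → ≤-trans (m≤n+m y d) x≥d+y)

  DDistinct⇒decreasing : ∀ {μ} → 1 ≤ d → DDistinct d μ → Decreasing μ
  DDistinct⇒decreasing 1≤d distinct =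
    AllPairs.map (λ {x} {y} x≥d+y → ≤-trans (+-monoˡ-≤ y 1≤d) x≥d+y) (DDistinct⇒AllPairs distinct)

  DDistinct⇒head> : ∀ {a μ} → 1 ≤ d → DDistinct d (a ∷ μ) → All (_< a) μ
  DDistinct⇒head> 1≤d distinct =
    All.map (λ {x} a≥d+x → ≤-trans (+-monoˡ-≤ x 1≤d) a≥d+x) (AllPairs.head (DDistinct⇒AllPairs distinct))

  DDistinct-gap : ∀ {μ x y} → DDistinct d μ → x ∈ μ → y ∈ μ → y < x → d + y ≤ x
  DDistinct-gap distinct = gap (DDistinct⇒AllPairs distinct)
    where
    gap : ∀ {μ x y} → AllPairs (λ x y → d + y ≤ x) μ → x ∈ μ → y ∈ μ → y < x → d + y ≤ x
    gap (_ ∷ _)     (here refl) (here refl) y<x = ⊥-elim (<-irrefl refl y<x)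
    gap (x≥ ∷ _)    (here refl) (there y∈)  _   = All.lookup x≥ y∈
    gap (y≥ ∷ _)    (there x∈)  (here refl) y<x = ⊥-elim (<⇒≱ y<x (≤-trans (m≤n+m _ d) (All.lookup y≥ x∈)))
    gap (_ ∷ pairs) (there x∈)  (there y∈)  y<x = gap pairs x∈ y∈ y<x

  ∈⇒last : ∀ {μ c} → DDistinct d μ → c ∈ μ → c < d → Σ (List ℕ) λ ρ → μ ≡ ρ ++ [ c ]
  ∈⇒last {x ∷ []}    _              (here refl) _   = [] , refl
  ∈⇒last {x ∷ y ∷ μ} (x≥d+y ∷ _)    (here refl) x<d = ⊥-elim (<⇒≱ x<d (≤-trans (m≤m+n d y) x≥d+y))
  ∈⇒last {x ∷ y ∷ μ} (_ ∷ distinct) (there c∈)  c<d =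
    let ρ , μ≡ = ∈⇒last distinct c∈ c<d in x ∷ ρ , cong (x ∷_) μ≡

  DDistinct-∷ʳ⁻ : ∀ ρ {c} → DDistinct d (ρ ++ [ c ]) → DDistinct d ρ × All (λ x → d + c ≤ x) ρ
  DDistinct-∷ʳ⁻ []          _                  = [] , []
  DDistinct-∷ʳ⁻ (x ∷ [])    (x≥d+c ∷ _)        = [-] , x≥d+c ∷ []
  DDistinct-∷ʳ⁻ (x ∷ y ∷ ρ) (x≥d+y ∷ distinct) with DDistinct-∷ʳ⁻ (y ∷ ρ) distinct
  ... | distinct′ , y≥d+c ∷ rest = x≥d+y ∷ distinct′ , ≤-trans y≥d+c (≤-trans (m≤n+m y d) x≥d+y) ∷ y≥d+c ∷ rest

  DDistinct-∷ʳ⁺ : ∀ ρ {c} → DDistinct d ρ → All (λ x → d + c ≤ x) ρ → DDistinct d (ρ ++ [ c ])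
  DDistinct-∷ʳ⁺ []          _                  _             = [-]
  DDistinct-∷ʳ⁺ (x ∷ [])    _                  (x≥d+c ∷ _)   = x≥d+c ∷ [-]
  DDistinct-∷ʳ⁺ (x ∷ y ∷ ρ) (x≥d+y ∷ distinct) (_ ∷ y∷ρ≥d+c) = x≥d+y ∷ DDistinct-∷ʳ⁺ (y ∷ ρ) distinct y∷ρ≥d+c

∷ʳ-lowerBound : ∀ ρ {c} → Nonincreasing (ρ ++ [ c ]) → All (c ≤_) (ρ ++ [ c ])
∷ʳ-lowerBound []          _                    = ≤-refl ∷ []
∷ʳ-lowerBound (x ∷ [])    (c≤x ∷ _)            = c≤x ∷ ≤-refl ∷ []
∷ʳ-lowerBound (x ∷ y ∷ ρ) (y≤x ∷ nonincreasing) with ∷ʳ-lowerBound (y ∷ ρ) nonincreasing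
... | c≤y ∷ rest = ≤-trans c≤y y≤x ∷ c≤y ∷ rest

-- Counting d-distinct lists by semiperimeter

-- λ₁ + ℓ(λ), which exceeds the corner hook length of a partition by one.
semiperimeter : List ℕ → ℕ
semiperimeter []       = 0
semiperimeter (x ∷ xs) = suc (x + length xs)

withCorner : ℕ → List ℕ → List ℕ
withCorner e ν = (e ∸ length ν) ∷ ν

semiperimeter-withCorner : ∀ {e} ν → length ν ≤ e → semiperimeter (withCorner e ν) ≡ suc e
semiperimeter-withCorner ν len≤e = cong suc (m∸n+n≡m len≤e)

<-semiperimeter-withCorner : ∀ e ν → e < semiperimeter (withCorner e ν)
<-semiperimeter-withCorner e ν = s≤s (≤-trans (m≤n+m∸n e (length ν)) (≤-reflexive (+-comm (length ν) _)))

length≤semiperimeter : ∀ ν → length ν ≤ semiperimeter ν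
length≤semiperimeter []      = z≤n
length≤semiperimeter (x ∷ ν) = s≤s (m≤n+m (length ν) x)

m<semiperimeter : ∀ {m x} ν → All (m ≤_) (x ∷ ν) → m < semiperimeter (x ∷ ν)
m<semiperimeter {x = x} ν (m≤x ∷ _) = s≤s (≤-trans m≤x (m≤m+n x (length ν)))

semiperimeter-tail : ∀ d {x y} ν → d + y ≤ x → semiperimeter (y ∷ ν) + d ≤ x + length (y ∷ ν)
semiperimeter-tail d {y = y} ν x≥d+y =
  ≤-trans (≤-reflexive (rearrange y (length ν) d)) (+-monoˡ-≤ (length (y ∷ ν)) x≥d+y)
  where
  rearrange : ∀ y l d → suc (y + l) + d ≡ d + y + suc l
  rearrange = solve-∀

DDistinct-withCorner : ∀ d {e} μ → DDistinct d μ → semiperimeter μ + d ≤ e → DDistinct d (withCorner e μ)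
DDistinct-withCorner d []      _        _    = [-]
DDistinct-withCorner d (y ∷ μ) distinct room =
  m+n≤o⇒m≤o∸n (d + y) (≤-trans (≤-reflexive (rearrange d y (length μ))) room) ∷ distinct
  where
  rearrange : ∀ d y l → d + y + suc l ≡ suc (y + l) + d
  rearrange = solve-∀

distinctCount : (d n k : ℕ) → ℕ
distinctCount d n k = ((n + d) ∸ d * k) C k

DistinctChain : (d m n k : ℕ) → List ℕ → Set
DistinctChain d m n k ρ = length ρ ≡ k × DDistinct d ρ × All (m ≤_) ρ × semiperimeter ρ ≤ m + n

module _ {d : ℕ} where

  withCorner-DistinctChain : ∀ {m n k} ν → DistinctChain d m (n ∸ d) k ν →
                             DistinctChain d m (suc n) (suc k) (withCorner (m + n) ν)
  withCorner-DistinctChain {m} {n} ν (len , distinct , bounded , sp≤) =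
    cong suc len , distinct′ , head≥m ν distinct′ bounded ∷ bounded ,
    ≤-reflexive (trans (semiperimeter-withCorner ν len≤) (sym (+-suc m n)))
    where
    open ≤-Reasoning
    len≤ : length ν ≤ m + n
    len≤ = begin
      length ν        ≤⟨ length≤semiperimeter ν ⟩
      semiperimeter ν ≤⟨ sp≤ ⟩
      m + (n ∸ d)     ≤⟨ +-monoʳ-≤ m (m∸n≤m n d) ⟩
      m + n           ∎
    room : ∀ ν → All (m ≤_) ν → semiperimeter ν ≤ m + (n ∸ d) → DDistinct d ν → DDistinct d (withCorner (m + n) ν)
    room []          _       _   _        = [-]
    room ν@(_ ∷ ν′) bounded sp≤ distinct =
      DDistinct-withCorner d ν distinct (m<x≤m+[n∸e]⇒x+e≤m+n (m<semiperimeter ν′ bounded) sp≤)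
    distinct′ = room ν bounded sp≤ distinct
    head≥m : ∀ ν → DDistinct d (withCorner (m + n) ν) → All (m ≤_) ν → m ≤ m + n ∸ length ν
    head≥m []      _         _         = m≤m+n m n
    head≥m (y ∷ ν) (gap ∷ _) (m≤y ∷ _) = ≤-trans m≤y (≤-trans (m≤n+m y d) gap)

  DistinctChain-attained : ∀ {m n k x} ν → DistinctChain d m (suc n) (suc k) (x ∷ ν) → x + length ν ≡ m + n →
                           DistinctChain d m (n ∸ d) k ν × x ∷ ν ≡ withCorner (m + n) ν
  DistinctChain-attained {m} {n} {x = x} ν (len , distinct , _ ∷ bounded , _) corner =
    (suc-injective len , Linked.tail distinct , bounded , tail-bound ν distinct corner) ,
    cong (_∷ ν) (trans (sym (m+n∸n≡m x (length ν))) (cong (_∸ length ν) corner))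
    where
    tail-bound : ∀ ν → DDistinct d (x ∷ ν) → x + length ν ≡ m + n → semiperimeter ν ≤ m + (n ∸ d)
    tail-bound []      _         _      = z≤n
    tail-bound (y ∷ ν) (gap ∷ _) corner =
      x+e≤m+n⇒x≤m+[n∸e] (≤-trans (semiperimeter-tail d ν gap) (≤-reflexive corner))

  -- Either the bound on the semiperimeter is not attained, or it is and the first part is
  -- determined by the others.
  DistinctChain-suc : ∀ m n k ρ →
    (DistinctChain d m n (suc k) ρ ⊎ Σ (List ℕ) λ ν → DistinctChain d m (n ∸ d) k ν × ρ ≡ withCorner (m + n) ν)
    ⇔ DistinctChain d m (suc n) (suc k) ρ
  DistinctChain-suc m n k ρ = mk⇔ join (split ρ)
    where
    join : _ → DistinctChain d m (suc n) (suc k) ρ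
    join (inj₁ (len , distinct , bounded , sp≤)) = len , distinct , bounded , ≤-trans sp≤ (+-monoʳ-≤ m (n≤1+n n))
    join (inj₂ (ν , chain , refl))               = withCorner-DistinctChain ν chain
    split : ∀ ρ → DistinctChain d m (suc n) (suc k) ρ →
            DistinctChain d m n (suc k) ρ ⊎
            Σ (List ℕ) λ ν → DistinctChain d m (n ∸ d) k ν × ρ ≡ withCorner (m + n) ν
    split ρ (len , distinct , bounded , sp≤) with semiperimeter ρ ≤? m + n
    ... | yes sp≤′ = inj₁ (len , distinct , bounded , sp≤′)
    split (x ∷ ν) chain@(_ , _ , _ , sp≤) | no sp≰ =
      inj₂ (ν , DistinctChain-attained ν chain (suc-injective (≤-antisym sp≤′ (≰⇒> sp≰))))
      where sp≤′ = ≤-trans sp≤ (≤-reflexive (+-suc m n))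

  distinctCount-∸ : ∀ n k → distinctCount d (n ∸ d) k ≡ (n ∸ d * k) C k
  distinctCount-∸ n k with d ≤? n
  ... | yes d≤n = cong (λ z → (z ∸ d * k) C k) (m∸n+n≡m d≤n)
  distinctCount-∸ n zero    | no _   = refl
  distinctCount-∸ n (suc k) | no d≰n =
    trans (cong (_C suc k) (m≤n⇒m∸n≡0 (begin
      n ∸ d + d   ≡⟨ cong (_+ d) (m≤n⇒m∸n≡0 n≤d) ⟩
      d           ≤⟨ m≤m*n d (suc k) ⟩
      d * suc k   ∎)))
    (sym (cong (_C suc k) (m≤n⇒m∸n≡0 (≤-trans n≤d (m≤m*n d (suc k))))))
    where
    open ≤-Reasoning
    n≤d = <⇒≤ (≰⇒> d≰n)

  ∸-pascal : ∀ n k → (n ∸ d * k) C suc k + (n ∸ d * k) C k ≡ (suc n ∸ d * k) C suc k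
  ∸-pascal n k with d * k ≤? n
  ... | yes dk≤n = begin
    (n ∸ d * k) C suc k + (n ∸ d * k) C k ≡⟨ +-comm _ ((n ∸ d * k) C k) ⟩
    (n ∸ d * k) C k + (n ∸ d * k) C suc k ≡⟨ nCk+nC[k+1]≡[n+1]C[k+1] (n ∸ d * k) k ⟩
    suc (n ∸ d * k) C suc k               ≡⟨ cong (_C suc k) (+-∸-assoc 1 dk≤n) ⟨
    (suc n ∸ d * k) C suc k               ∎
    where open ≡-Reasoning
  ∸-pascal n zero    | no dk≰n = ⊥-elim (dk≰n (≤-trans (≤-reflexive (*-zeroʳ d)) z≤n))
  ∸-pascal n (suc k) | no dk≰n =
    trans (cong₂ (λ a b → a C suc (suc k) + b C suc k) n∸dk≡0 n∸dk≡0) (cong (_C suc (suc k)) (sym 1+n∸dk≡0))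
    where
    n∸dk≡0   = m≤n⇒m∸n≡0 (<⇒≤ (≰⇒> dk≰n))
    1+n∸dk≡0 = m≤n⇒m∸n≡0 (≰⇒> dk≰n)

  distinctCount-suc : ∀ n k →
                      distinctCount d n (suc k) + distinctCount d (n ∸ d) k ≡ distinctCount d (suc n) (suc k)
  distinctCount-suc n k = begin
    distinctCount d n (suc k) + distinctCount d (n ∸ d) k
      ≡⟨ cong₂ _+_ (cong (_C suc k) (shift n)) (distinctCount-∸ n k) ⟩
    (n ∸ d * k) C suc k + (n ∸ d * k) C k
      ≡⟨ ∸-pascal n k ⟩
    (suc n ∸ d * k) C suc k
      ≡⟨ cong (_C suc k) (shift (suc n)) ⟨
    distinctCount d (suc n) (suc k)
      ∎
    where
    open ≡-Reasoning
    shift : ∀ n → (n + d) ∸ d * suc k ≡ n ∸ d * k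
    shift n = trans (cong₂ _∸_ (+-comm n d) (*-suc d k)) ([m+n]∸[m+o]≡n∸o d n (d * k))

  DistinctChain-count : ∀ m n k → HasCount (DistinctChain d m n k) (distinctCount d n k)
  DistinctChain-count m n zero = HasCount-resp only-[] (HasCount-singleton [])
    where
    only-[] : ∀ ρ → ρ ≡ [] ⇔ DistinctChain d m n 0 ρ
    only-[] ρ = mk⇔ (λ { refl → refl , [] , [] , z≤n }) (λ { (len , _) → length≡0 ρ len })
      where
      length≡0 : ∀ ρ → length ρ ≡ 0 → ρ ≡ []
      length≡0 [] _ = refl
  DistinctChain-count m zero (suc k) =
    subst (HasCount _) (cong (_C suc k) (sym (m≤n⇒m∸n≡0 (m≤m*n d (suc k))))) (HasCount-∅ empty)
    where
    empty : ∀ ρ → ¬ DistinctChain d m 0 (suc k) ρ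
    empty (x ∷ ν) (_ , _ , bounded , sp≤) =
      <-irrefl refl (<-≤-trans (m<semiperimeter ν bounded) (≤-trans sp≤ (≤-reflexive (+-identityʳ m))))
  DistinctChain-count m (suc n) (suc k) =
    subst (HasCount _) (distinctCount-suc n k)
      (HasCount-resp (DistinctChain-suc m n k)
        (HasCount-⊎ disjoint (DistinctChain-count m n (suc k))
                             (HasCount-image (withCorner (m + n)) ∷-injectiveʳ (DistinctChain-count m (n ∸ d) k))))
    where
    disjoint : ∀ {ρ} → DistinctChain d m n (suc k) ρ → (Σ (List ℕ) λ ν → _ × ρ ≡ withCorner (m + n) ν) → ⊥
    disjoint (_ , _ , _ , sp≤) (ν , _ , refl) =
      <-irrefl refl (≤-<-trans sp≤ (<-semiperimeter-withCorner (m + n) ν))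

-- Parts below a column

-- hook (a ∷ μ) zero j unfolds to 1 + (a ∸ suc j) + partsAbove j μ.
partsAbove : ℕ → List ℕ → ℕ
partsAbove j μ = length (filter (j <?_) μ)

multiplicity : ℕ → List ℕ → ℕ
multiplicity v []      = 0
multiplicity v (x ∷ μ) with x ≟ v
... | yes _ = suc (multiplicity v μ)
... | no  _ = multiplicity v μ

partsAbove-accept : ∀ μ → j < x → partsAbove j (x ∷ μ) ≡ suc (partsAbove j μ)
partsAbove-accept {j} _ j<x = cong length (filter-accept (j <?_) j<x)

partsAbove-reject : ∀ μ → ¬ j < x → partsAbove j (x ∷ μ) ≡ partsAbove j μ
partsAbove-reject {j} _ j≮x = cong length (filter-reject (j <?_) j≮x)

partsAbove≤length : ∀ j μ → partsAbove j μ ≤ length μ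
partsAbove≤length j []      = z≤n
partsAbove≤length j (x ∷ μ) with j <? x
... | yes j<x rewrite partsAbove-accept μ j<x = s≤s (partsAbove≤length j μ)
... | no  j≮x rewrite partsAbove-reject μ j≮x = m≤n⇒m≤1+n (partsAbove≤length j μ)

partsAbove-all : ∀ {μ} → All (j <_) μ → partsAbove j μ ≡ length μ
partsAbove-all []                    = refl
partsAbove-all {μ = _ ∷ μ} (j<x ∷ all) rewrite partsAbove-accept μ j<x = cong suc (partsAbove-all all)

partsAbove-none : ∀ {μ} → All (_≤ j) μ → partsAbove j μ ≡ 0
partsAbove-none []                    = refl
partsAbove-none {μ = _ ∷ μ} (x≤j ∷ none) rewrite partsAbove-reject μ (≤⇒≯ x≤j) = partsAbove-none none

partsAbove<length : ∀ {x j μ} → x ∈ μ → x ≤ j → partsAbove j μ < length μ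
partsAbove<length {j = j} {μ = y ∷ μ} (here refl) x≤j rewrite partsAbove-reject μ (≤⇒≯ x≤j) =
  s≤s (partsAbove≤length j μ)
partsAbove<length {j = j} {μ = y ∷ μ} (there x∈μ) x≤j with j <? y
... | yes j<y rewrite partsAbove-accept μ j<y = s≤s (partsAbove<length x∈μ x≤j)
... | no  j≮y rewrite partsAbove-reject μ j≮y = m≤n⇒m≤1+n (partsAbove<length x∈μ x≤j)

partsAbove-antitone : ∀ μ → i ≤ j → partsAbove j μ ≤ partsAbove i μ
partsAbove-antitone []                  _   = z≤n
partsAbove-antitone {i} {j} (x ∷ μ) i≤j with i <? x | j <? x
... | yes i<x | yes j<x rewrite partsAbove-accept μ i<x | partsAbove-accept μ j<x =
  s≤s (partsAbove-antitone μ i≤j)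
... | yes i<x | no  j≮x rewrite partsAbove-accept μ i<x | partsAbove-reject μ j≮x =
  m≤n⇒m≤1+n (partsAbove-antitone μ i≤j)
... | no  i≮x | yes j<x = ⊥-elim (i≮x (≤-<-trans i≤j j<x))
... | no  i≮x | no  j≮x rewrite partsAbove-reject μ i≮x | partsAbove-reject μ j≮x =
  partsAbove-antitone μ i≤j

partsAbove-suc : ∀ j μ → partsAbove j μ ≡ partsAbove (suc j) μ + multiplicity (suc j) μ
partsAbove-suc j []      = refl
partsAbove-suc j (x ∷ μ) with j <? x | suc j <? x | x ≟ suc j
... | yes _   | yes j<x | yes refl = ⊥-elim (<-irrefl refl j<x)
... | yes j<x | yes 1+j<x | no _
  rewrite partsAbove-accept μ j<x | partsAbove-accept μ 1+j<x = cong suc (partsAbove-suc j μ)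
... | yes j<x | no 1+j≮x | yes refl
  rewrite partsAbove-accept μ j<x | partsAbove-reject μ 1+j≮x =
  trans (cong suc (partsAbove-suc j μ)) (sym (+-suc _ _))
... | yes j<x | no 1+j≮x | no x≢1+j = ⊥-elim (x≢1+j (≤-antisym (≮⇒≥ 1+j≮x) j<x))
... | no j≮x  | yes 1+j<x | _ = ⊥-elim (j≮x (<-trans (n<1+n j) 1+j<x))
... | no j≮x  | no _      | yes refl = ⊥-elim (j≮x (n<1+n j))
... | no j≮x  | no 1+j≮x  | no _
  rewrite partsAbove-reject μ j≮x | partsAbove-reject μ 1+j≮x = partsAbove-suc j μ

multiplicity⇒∈ : ∀ μ → 1 ≤ multiplicity v μ → v ∈ μ
multiplicity⇒∈ {v} (x ∷ μ) 1≤m with x ≟ v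
... | yes refl = here refl
... | no  _    = there (multiplicity⇒∈ μ 1≤m)

∈⇒multiplicity : ∀ {v μ} → v ∈ μ → 1 ≤ multiplicity v μ
∈⇒multiplicity {v} {x ∷ μ} v∈ with x ≟ v | v∈
... | yes _   | _          = s≤s z≤n
... | no  x≢v | here refl  = ⊥-elim (x≢v refl)
... | no  _   | there v∈μ  = ∈⇒multiplicity v∈μ

multiplicity-none : ∀ {v μ} → All (_< v) μ → multiplicity v μ ≡ 0
multiplicity-none [] = refl
multiplicity-none {v} {x ∷ μ} (x<v ∷ below) with x ≟ v
... | yes refl = ⊥-elim (<-irrefl refl x<v)
... | no  _    = multiplicity-none below

multiplicity≤1 : ∀ {v μ} → Decreasing μ → multiplicity v μ ≤ 1
multiplicity≤1 [] = z≤n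
multiplicity≤1 {v} {x ∷ μ} (below ∷ decreasing) with x ≟ v
... | yes refl = ≤-reflexive (cong suc (multiplicity-none below))
... | no  _    = multiplicity≤1 decreasing

partsAbove-<-∈ : ∀ μ → i < v → v ∈ μ → partsAbove v μ < partsAbove i μ
partsAbove-<-∈ {i} {suc v} μ (s≤s i≤v) v∈μ = begin-strict
  partsAbove (suc v) μ                            <⟨ m<m+n _ (∈⇒multiplicity v∈μ) ⟩
  partsAbove (suc v) μ + multiplicity (suc v) μ   ≡⟨ partsAbove-suc v μ ⟨
  partsAbove v μ                                  ≤⟨ partsAbove-antitone μ i≤v ⟩
  partsAbove i μ                                  ∎
  where open ≤-Reasoning

partsAbove-last : ∀ ρ → All (x <_) ρ → partsAbove x (ρ ++ [ x ]) ≡ length ρ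
partsAbove-last {x} ρ above = begin
  length (filter (x <?_) (ρ ++ [ x ]))              ≡⟨ cong length (filter-++ (x <?_) ρ [ x ]) ⟩
  length (filter (x <?_) ρ ++ filter (x <?_) [ x ]) ≡⟨ length-++ (filter (x <?_) ρ) ⟩
  partsAbove x ρ + partsAbove x [ x ]               ≡⟨ cong₂ _+_ (partsAbove-all above) x-not-above-x ⟩
  length ρ + 0                                      ≡⟨ +-identityʳ _ ⟩
  length ρ                                          ∎
  where
  open ≡-Reasoning
  x-not-above-x = partsAbove-none {x} (≤-refl ∷ [])

-- First-row hook lengths

hit-or-skip : (f : ℕ → ℕ) (n t : ℕ) → (∀ i → i < n → f i ≤ 2 + f (suc i)) → f n ≤ t → t ≤ f 0 →
              (Σ ℕ λ i → i ≤ n × f i ≡ t) ⊎ (Σ ℕ λ i → i < n × f i ≡ suc t × suc (f (suc i)) ≡ t)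
hit-or-skip f zero    t _    fn≤t t≤f0 = inj₁ (0 , z≤n , ≤-antisym fn≤t t≤f0)
hit-or-skip f (suc n) t slow fn≤t t≤f0 with f n ≤? t
... | yes fn≤t′ with hit-or-skip f n t (λ i i<n → slow i (m<n⇒m<1+n i<n)) fn≤t′ t≤f0
...   | inj₁ (i , i≤n , hit)         = inj₁ (i , m≤n⇒m≤1+n i≤n , hit)
...   | inj₂ (i , i<n , above , below) = inj₂ (i , m<n⇒m<1+n i<n , above , below)
hit-or-skip f (suc n) t slow fn≤t t≤f0 | no fn≰t with f (suc n) ≟ t
... | yes hit = inj₁ (suc n , ≤-refl , hit)
... | no  miss = inj₂ (n , ≤-refl , ≤-antisym fn≤1+t t<fn , sym below)
  where
  t<fn = ≰⇒> fn≰t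
  below : t ≡ suc (f (suc n))
  below = ≤-antisym (≤-pred (≤-trans t<fn (slow n ≤-refl))) (≤∧≢⇒< fn≤t miss)
  fn≤1+t = ≤-trans (slow n ≤-refl) (s≤s (≤-reflexive (sym below)))

module _ {a : ℕ} where

  firstRowHook+j : ∀ {j} μ → j < a → hook (a ∷ μ) zero j + j ≡ a + partsAbove j μ
  firstRowHook+j {j} μ j<a = begin
    suc ((a ∸ suc j) + partsAbove j μ) + j ≡⟨ rearrange (a ∸ suc j) (partsAbove j μ) j ⟩
    (a ∸ suc j) + suc j + partsAbove j μ   ≡⟨ cong (_+ partsAbove j μ) (m∸n+n≡m j<a) ⟩
    a + partsAbove j μ                     ∎
    where
    open ≡-Reasoning
    rearrange : ∀ x p j → suc (x + p) + j ≡ x + suc j + p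
    rearrange = solve-∀

  firstRowHook-antitone : ∀ {i j} μ → i ≤ j → hook (a ∷ μ) zero j ≤ hook (a ∷ μ) zero i
  firstRowHook-antitone μ i≤j = s≤s (+-mono-≤ (∸-monoʳ-≤ a (s≤s i≤j)) (partsAbove-antitone μ i≤j))

  firstRowHook-step : ∀ {j} μ → suc j < a →
                      hook (a ∷ μ) zero j ≡ suc (hook (a ∷ μ) zero (suc j) + multiplicity (suc j) μ)
  firstRowHook-step {j} μ 1+j<a = +-cancelʳ-≡ j _ _ (begin
    H j + j                        ≡⟨ firstRowHook+j μ (<-trans (n<1+n j) 1+j<a) ⟩
    a + partsAbove j μ             ≡⟨ cong (_+_ a) (partsAbove-suc j μ) ⟩
    a + (partsAbove (suc j) μ + k) ≡⟨ +-assoc a _ k ⟨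
    a + partsAbove (suc j) μ + k   ≡⟨ cong (_+ k) (firstRowHook+j μ 1+j<a) ⟨
    H (suc j) + suc j + k          ≡⟨ rearrange (H (suc j)) j k ⟩
    suc (H (suc j) + k) + j        ∎)
    where
    open ≡-Reasoning
    H = hook (a ∷ μ) zero
    k = multiplicity (suc j) μ
    rearrange : ∀ h j k → h + suc j + k ≡ suc (h + k) + j
    rearrange = solve-∀

  cornerHook : ∀ μ → 0 < a → All (0 <_) μ → hook (a ∷ μ) zero 0 ≡ a + length μ
  cornerHook μ 0<a positive =
    trans (sym (+-identityʳ _)) (trans (firstRowHook+j μ 0<a) (cong (_+_ a) (partsAbove-all positive)))

hook≤cornerHook : ∀ a μ → Nonincreasing (a ∷ μ) → (i : Fin (length (a ∷ μ))) (j : ℕ) →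
                  j < lookup (a ∷ μ) i → hook (a ∷ μ) i j ≤ a + length μ
hook≤cornerHook a μ _ zero j j<a = begin
  hook (a ∷ μ) zero j     ≤⟨ m≤m+n _ j ⟩
  hook (a ∷ μ) zero j + j ≡⟨ firstRowHook+j μ j<a ⟩
  a + partsAbove j μ      ≤⟨ +-monoʳ-≤ a (partsAbove≤length j μ) ⟩
  a + length μ            ∎
  where open ≤-Reasoning
hook≤cornerHook a (b ∷ ν) (b≤a ∷ nonincreasing) (suc i) j j<λᵢ =
  ≤-trans (hook≤cornerHook b ν nonincreasing i j j<λᵢ) (+-mono-≤ b≤a (n≤1+n (length ν)))

firstRowHook-slow : ∀ {a i} μ → Decreasing μ → suc i < a →
                    hook (a ∷ μ) zero i ≤ 2 + hook (a ∷ μ) zero (suc i)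
firstRowHook-slow {a} {i} μ decreasing 1+i<a = begin
  H i                                      ≡⟨ firstRowHook-step μ 1+i<a ⟩
  suc (H (suc i) + multiplicity (suc i) μ) ≤⟨ s≤s (+-monoʳ-≤ _ (multiplicity≤1 decreasing)) ⟩
  suc (H (suc i) + 1)                      ≡⟨ cong suc (+-comm _ 1) ⟩
  2 + H (suc i)                            ∎
  where
  open ≤-Reasoning
  H = hook (a ∷ μ) zero

firstRowHook-jump⇒∈ : ∀ {a i} μ → suc i < a → hook (a ∷ μ) zero i ≡ 2 + hook (a ∷ μ) zero (suc i) →
                      suc i ∈ μ
firstRowHook-jump⇒∈ {a} {i} μ 1+i<a jump = multiplicity⇒∈ μ (≤-reflexive (sym once))
  where
  open ≡-Reasoning
  H = hook (a ∷ μ) zero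
  once : multiplicity (suc i) μ ≡ 1
  once = +-cancelˡ-≡ _ _ _ (suc-injective (begin
    suc (H (suc i) + multiplicity (suc i) μ) ≡⟨ firstRowHook-step μ 1+i<a ⟨
    H i                                      ≡⟨ jump ⟩
    2 + H (suc i)                            ≡⟨ cong suc (+-comm 1 _) ⟩
    suc (H (suc i) + 1)                      ∎))

lastColumnHook : ∀ {a} μ → All (_< suc a) μ → hook (suc a ∷ μ) zero a ≡ 1
lastColumnHook {a} μ below = cong₂ (λ x y → suc (x + y)) (n∸n≡0 a) (partsAbove-none (All.map ≤-pred below))

firstRow-hit-or-skip : ∀ {a t} μ → 0 < a → All (_< a) μ → Decreasing μ →
                       1 ≤ t → t ≤ hook (a ∷ μ) zero 0 →
                       (Σ ℕ λ j → j < a × hook (a ∷ μ) zero j ≡ t) ⊎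
                       (Σ ℕ λ b → b ∈ μ × b < a × suc (hook (a ∷ μ) zero b) ≡ t)
firstRow-hit-or-skip {suc a} {t} μ _ below decreasing 1≤t t≤corner
  with hit-or-skip (hook (suc a ∷ μ) zero) a t (λ i i<a → firstRowHook-slow μ decreasing (s≤s i<a))
                   (≤-trans (≤-reflexive (lastColumnHook μ below)) 1≤t) t≤corner
... | inj₁ (j , j≤a , hit) = inj₁ (j , s≤s j≤a , hit)
... | inj₂ (i , i<a , above , skip) =
  inj₂ (suc i , firstRowHook-jump⇒∈ μ (s≤s i<a) (trans above (cong suc (sym skip))) , s≤s i<a , skip)

firstRowHook+part<cornerHook : ∀ {a b} μ → b ∈ μ → b < a → suc (hook (a ∷ μ) zero b + b) ≤ a + length μ
firstRowHook+part<cornerHook {a} {b} μ b∈μ b<a = begin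
  suc (hook (a ∷ μ) zero b + b) ≡⟨ cong suc (firstRowHook+j μ b<a) ⟩
  suc (a + partsAbove b μ)      ≡⟨ +-suc a _ ⟨
  a + suc (partsAbove b μ)      ≤⟨ +-monoʳ-≤ a (partsAbove<length b∈μ ≤-refl) ⟩
  a + length μ                  ∎
  where open ≤-Reasoning

cornerHook-at-last : ∀ {a b} ρ → b < a → All (b <_) ρ →
                     a + length (ρ ++ [ b ]) ≡ suc (hook (a ∷ ρ ++ [ b ]) zero b + b)
cornerHook-at-last {a} {b} ρ b<a ρ>b = begin
  a + length (ρ ++ [ b ])              ≡⟨ cong (_+_ a) (trans (length-++ ρ) (+-comm (length ρ) 1)) ⟩
  a + suc (length ρ)                   ≡⟨ cong (λ p → a + suc p) (partsAbove-last ρ ρ>b) ⟨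
  a + suc (partsAbove b (ρ ++ [ b ]))  ≡⟨ +-suc a _ ⟩
  suc (a + partsAbove b (ρ ++ [ b ]))  ≡⟨ cong suc (firstRowHook+j (ρ ++ [ b ]) b<a) ⟨
  suc (hook (a ∷ ρ ++ [ b ]) zero b + b) ∎
  where open ≡-Reasoning

core⇒partSkip : ∀ {d a t} → 1 ≤ d → ∀ μ → All (0 <_) (a ∷ μ) → DDistinct d (a ∷ μ) → IsCore t (a ∷ μ) →
                1 ≤ t → t ≤ a + length μ → Σ ℕ λ b → b ∈ μ × b < a × suc (hook (a ∷ μ) zero b) ≡ t
core⇒partSkip 1≤d μ (0<a ∷ positive) distinct core 1≤t t≤corner
  with firstRow-hit-or-skip μ 0<a (DDistinct⇒head> 1≤d distinct) (DDistinct⇒decreasing 1≤d (Linked.tail distinct))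
         1≤t (≤-trans t≤corner (≤-reflexive (sym (cornerHook μ 0<a positive))))
... | inj₁ (j , j<a , hit) = ⊥-elim (core zero j j<a hit)
... | inj₂ skip            = skip

-- Characterisation of the (s, s + r)-cores

-- a + length (ρ ++ [ c ]) is the hook length of the corner cell.
Tight : (s c : ℕ) → List ℕ → Set
Tight s c λ′ = Σ ℕ λ a → Σ (List ℕ) λ ρ → λ′ ≡ a ∷ ρ ++ [ c ] × a + length (ρ ++ [ c ]) ≡ s + c

core-beyond-cornerHook : ∀ {t} a μ → Nonincreasing (a ∷ μ) → a + length μ < t → IsCore t (a ∷ μ)
core-beyond-cornerHook a μ nonincreasing corner<t i j j<λᵢ hook≡t =
  <-irrefl hook≡t (≤-<-trans (hook≤cornerHook a μ nonincreasing i j j<λᵢ) corner<t)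

lowerRowHook-bound : ∀ {d a y} ν → d + y ≤ a → Nonincreasing (y ∷ ν) →
                     (i : Fin (length (y ∷ ν))) (j : ℕ) → j < lookup (y ∷ ν) i →
                     d + hook (y ∷ ν) i j < a + length (y ∷ ν)
lowerRowHook-bound {d} {a} {y} ν a≥d+y nonincreasing i j j<νᵢ = begin-strict
  d + hook (y ∷ ν) i j     ≤⟨ +-monoʳ-≤ d (hook≤cornerHook y ν nonincreasing i j j<νᵢ) ⟩
  d + (y + length ν)       ≡⟨ +-assoc d y (length ν) ⟨
  d + y + length ν         <⟨ +-monoʳ-< (d + y) (n<1+n (length ν)) ⟩
  d + y + length (y ∷ ν)   ≤⟨ +-monoˡ-≤ _ a≥d+y ⟩
  a + length (y ∷ ν)       ∎
  where open ≤-Reasoning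

firstRowHook-gap : ∀ {d a b b′} μ → b ∈ μ → b′ < b → d + b′ ≤ b → b < a →
                   hook (a ∷ μ) zero b + d < hook (a ∷ μ) zero b′
firstRowHook-gap {d} {a} {b} {b′} μ b∈ b′<b b≥d+b′ b<a = +-cancelʳ-< b′ _ _ (begin-strict
  hook (a ∷ μ) zero b + d + b′    ≡⟨ +-assoc _ d b′ ⟩
  hook (a ∷ μ) zero b + (d + b′)  ≤⟨ +-monoʳ-≤ _ b≥d+b′ ⟩
  hook (a ∷ μ) zero b + b         ≡⟨ firstRowHook+j μ b<a ⟩
  a + partsAbove b μ              <⟨ +-monoʳ-< a (partsAbove-<-∈ μ b′<b b∈) ⟩
  a + partsAbove b′ μ             ≡⟨ firstRowHook+j μ (<-trans b′<b b<a) ⟨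
  hook (a ∷ μ) zero b′ + b′       ∎)
  where open ≤-Reasoning

module _ {d r s : ℕ} (r≤d : r ≤ d) where

  small⇒cores : ∀ {λ′} → DDistinct d λ′ → semiperimeter λ′ ≤ s → IsCore s λ′ × IsCore (s + r) λ′
  small⇒cores {[]}    _        _     = (λ ()) , (λ ())
  small⇒cores {a ∷ μ} distinct small =
    core-beyond-cornerHook a μ nonincreasing small , core-beyond-cornerHook a μ nonincreasing (≤-trans small (m≤m+n s r))
    where nonincreasing = DDistinct⇒nonincreasing distinct

  tight⇒cores : ∀ {c λ′} → DDistinct d λ′ → c < r → Tight s c λ′ → IsCore s λ′ × IsCore (s + r) λ′
  tight⇒cores {c} distinct c<r (a , ρ , refl , corner) =
    core-s , core-beyond-cornerHook a μ (DDistinct⇒nonincreasing distinct) (begin-strict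
      a + length μ ≡⟨ corner ⟩
      s + c        <⟨ +-monoʳ-< s c<r ⟩
      s + r        ∎)
    where
    open ≤-Reasoning
    μ = ρ ++ [ c ]
    c<d = <-≤-trans c<r r≤d
    c≤μ : All (c ≤_) μ
    c≤μ = ∷ʳ-lowerBound ρ (DDistinct⇒nonincreasing (Linked.tail distinct))
    -- First-row hooks exceed s left of column c and fall below s from column c on.
    core-s : IsCore s (a ∷ μ)
    core-s zero j j<a hook≡s with j <? c
    ... | yes j<c = <-irrefl (+-cancelˡ-≡ s j c (begin-equality
      s + j                   ≡⟨ cong (_+ j) hook≡s ⟨
      hook (a ∷ μ) zero j + j ≡⟨ firstRowHook+j μ j<a ⟩
      a + partsAbove j μ      ≡⟨ cong (_+_ a) (partsAbove-all (All.map (<-≤-trans j<c) c≤μ)) ⟩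
      a + length μ            ≡⟨ corner ⟩
      s + c                   ∎)) j<c
    ... | no j≮c = <-irrefl refl (begin-strict
      s + j                   ≡⟨ cong (_+ j) hook≡s ⟨
      hook (a ∷ μ) zero j + j ≡⟨ firstRowHook+j μ j<a ⟩
      a + partsAbove j μ      <⟨ +-monoʳ-< a (partsAbove<length (∈-++⁺ʳ ρ (here refl)) (≮⇒≥ j≮c)) ⟩
      a + length μ            ≡⟨ corner ⟩
      s + c                   ≤⟨ +-monoʳ-≤ s (≮⇒≥ j≮c) ⟩
      s + j                   ∎)
    core-s (suc i) = lowerRows μ distinct corner i
      where
      lowerRows : ∀ μ → DDistinct d (a ∷ μ) → a + length μ ≡ s + c → IsCore s μ
      lowerRows (y ∷ ν) (a≥d+y ∷ distinct′) corner i j j<μᵢ refl = <-asym c<d (+-cancelˡ-< s d c (begin-strict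
        s + d                      ≡⟨ +-comm s d ⟩
        d + hook (y ∷ ν) i j       <⟨ lowerRowHook-bound ν a≥d+y (DDistinct⇒nonincreasing distinct′) i j j<μᵢ ⟩
        a + length (y ∷ ν)         ≡⟨ corner ⟩
        s + c                      ∎))

  firstRow-no-two-skips : 1 ≤ r → ∀ {a b b′} μ → DDistinct d μ → b ∈ μ → b′ ∈ μ → b < a → b′ < a →
                          suc (hook (a ∷ μ) zero b) ≡ s → suc (hook (a ∷ μ) zero b′) ≡ s + r → ⊥
  firstRow-no-two-skips 1≤r {a} {b} {b′} μ distinct b∈ b′∈ b<a b′<a skip skip′ with b ≤? b′
  ... | yes b≤b′ = <-irrefl refl (begin-strict
    s                           <⟨ m<m+n s 1≤r ⟩
    s + r                       ≡⟨ skip′ ⟨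
    suc (hook (a ∷ μ) zero b′)  ≤⟨ s≤s (firstRowHook-antitone {a} μ b≤b′) ⟩
    suc (hook (a ∷ μ) zero b)   ≡⟨ skip ⟩
    s                           ∎)
    where open ≤-Reasoning
  ... | no b≰b′ = <-irrefl refl (begin-strict
    s + r                       ≤⟨ +-monoʳ-≤ s r≤d ⟩
    s + d                       ≡⟨ cong (_+ d) skip ⟨
    suc (hook (a ∷ μ) zero b) + d ≤⟨ firstRowHook-gap μ b∈ b′<b (DDistinct-gap distinct b∈ b′∈ b′<b) b<a ⟩
    hook (a ∷ μ) zero b′        <⟨ n<1+n _ ⟩
    suc (hook (a ∷ μ) zero b′)  ≡⟨ skip′ ⟩
    s + r                       ∎)
    where
    open ≤-Reasoning
    b′<b = ≰⇒> b≰b′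

  cornerHook<s+r : 1 ≤ r → ∀ {a b} μ → All (0 <_) (a ∷ μ) → DDistinct d (a ∷ μ) → IsCore (s + r) (a ∷ μ) →
                   b ∈ μ → b < a → suc (hook (a ∷ μ) zero b) ≡ s → a + length μ < s + r
  cornerHook<s+r 1≤r {a} μ positive distinct core′ b∈μ b<a skip≡s with a + length μ <? s + r
  ... | yes corner<s+r = corner<s+r
  ... | no  corner≮s+r =
    let b′ , b′∈μ , b′<a , skip≡s+r = core⇒partSkip (≤-trans 1≤r r≤d) μ positive distinct core′
                                        (≤-trans 1≤r (m≤n+m r s)) (≮⇒≥ corner≮s+r)
    in ⊥-elim (firstRow-no-two-skips 1≤r μ (Linked.tail distinct) b∈μ b′∈μ b<a b′<a skip≡s skip≡s+r)

  tight-at-last : 1 ≤ d → ∀ {a b} μ → (Σ (List ℕ) λ ρ → μ ≡ ρ ++ [ b ]) → DDistinct d (a ∷ μ) → b < a →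
                  suc (hook (a ∷ μ) zero b) ≡ s → Tight s b (a ∷ μ)
  tight-at-last 1≤d {a} {b} _ (ρ , refl) distinct b<a skip≡s =
    a , ρ , refl , trans (cornerHook-at-last ρ b<a ρ>b) (cong (_+ b) skip≡s)
    where
    ρ>b = All.map (λ {x} x≥d+b → ≤-trans (+-monoˡ-≤ b 1≤d) x≥d+b) (proj₂ (DDistinct-∷ʳ⁻ ρ (Linked.tail distinct)))

  -- s is skipped at some part b, and s + r must then lie above the corner hook, which is at least
  -- s + b; so b < r ≤ d, which makes b the last part.
  cores⇒small-or-tight : 1 ≤ r → 1 ≤ s → ∀ {λ′} → All (0 <_) λ′ → DDistinct d λ′ →
                         IsCore s λ′ → IsCore (s + r) λ′ → semiperimeter λ′ ≤ s ⊎ Σ ℕ λ c → c < r × Tight s c λ′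
  cores⇒small-or-tight 1≤r 1≤s {[]} _ _ _ _ = inj₁ z≤n
  cores⇒small-or-tight 1≤r 1≤s {a ∷ μ} positive distinct core core′ with semiperimeter (a ∷ μ) ≤? s
  ... | yes small = inj₁ small
  ... | no  large = inj₂ (tight (core⇒partSkip 1≤d μ positive distinct core 1≤s (≤-pred (≰⇒> large))))
    where
    1≤d = ≤-trans 1≤r r≤d
    tight : (Σ ℕ λ b → b ∈ μ × b < a × suc (hook (a ∷ μ) zero b) ≡ s) → Σ ℕ λ c → c < r × Tight s c (a ∷ μ)
    tight (b , b∈μ , b<a , skip≡s) =
      b , b<r , tight-at-last 1≤d μ (∈⇒last (Linked.tail distinct) b∈μ (<-≤-trans b<r r≤d)) distinct b<a skip≡s
      where
      open ≤-Reasoning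
      b<r : b < r
      b<r = +-cancelˡ-< s b r (begin-strict
        s + b                         ≡⟨ cong (_+ b) skip≡s ⟨
        suc (hook (a ∷ μ) zero b + b) ≤⟨ firstRowHook+part<cornerHook μ b∈μ b<a ⟩
        a + length μ                  <⟨ cornerHook<s+r 1≤r μ positive distinct core′ b∈μ b<a skip≡s ⟩
        s + r                         ∎)

x-m-n≡x-[m+n] : ∀ x m n → x ℤ.- + m ℤ.- + n ≡ x ℤ.- + (m + n)
x-m-n≡x-[m+n] x m n = rearrange x (+ m) (+ n)
  where
  rearrange : ∀ x a b → x ℤ.- a ℤ.- b ≡ x ℤ.- (a ℤ.+ b)
  rearrange = ℤ-Solver.solve-∀

x-m-n≡⊖ : ∀ x m n → + x ℤ.- + m ℤ.- + n ≡ x ⊖ (m + n)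
x-m-n≡⊖ x m n = trans (x-m-n≡x-[m+n] (+ x) m n) (ℤ.m-n≡m⊖n x (m + n))

≤-ceilDiv : ∀ a b .{{_ : NonZero b}} k → + (k * b) ℤ.< a ℤ.+ + b → + k ℤ.≤ ceilDiv a b
≤-ceilDiv a b k kb<a+b = subst (ℤ._≤ ceilDiv a b) (1-[1-k]≡k (+ k)) (ℤ.i<j⇒suc[i]≤j (ℤ.neg-mono-< q<1-k))
  where
  q = (ℤ.- a) /ℕ b
  -a<[1-k]b : ℤ.- a ℤ.< (+ 1 ℤ.- + k) ℤ.* + b
  -a<[1-k]b = subst₂ ℤ._<_ (-[a+b]+b≡-a a (+ b)) (-[kb]+b≡[1-k]b (+ k) (+ b))
                (ℤ.+-monoˡ-< (+ b) (ℤ.neg-mono-< (subst (ℤ._< a ℤ.+ + b) (ℤ.pos-* k b) kb<a+b)))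
    where
    -[a+b]+b≡-a : ∀ a b → ℤ.- (a ℤ.+ b) ℤ.+ b ≡ ℤ.- a
    -[a+b]+b≡-a = ℤ-Solver.solve-∀
    -[kb]+b≡[1-k]b : ∀ k b → ℤ.- (k ℤ.* b) ℤ.+ b ≡ (+ 1 ℤ.- k) ℤ.* b
    -[kb]+b≡[1-k]b = ℤ-Solver.solve-∀
  q<1-k : q ℤ.< + 1 ℤ.- + k
  q<1-k = ℤ.*-cancelʳ-<-nonNeg (+ b) (ℤ.≤-<-trans ([n/ℕd]*d≤n (ℤ.- a) b) -a<[1-k]b)
  1-[1-k]≡k : ∀ k → + 1 ℤ.+ ℤ.- (+ 1 ℤ.- k) ≡ k
  1-[1-k]≡k = ℤ-Solver.solve-∀

Cℤ≢0⇒≤ceilDiv : ∀ x d k → Cℤ (x ℤ.- + (d * k) ℤ.- + 1) k ≢ 0 → + k ℤ.≤ ceilDiv (x ℤ.- + d ℤ.- + 1) (suc d)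
Cℤ≢0⇒≤ceilDiv x d k C≢0 with x ℤ.- + (d * k) ℤ.- + 1 in top≡
... | -[1+ _ ] = ⊥-elim (C≢0 refl)
... | + n = ≤-ceilDiv (x ℤ.- + d ℤ.- + 1) (suc d) k (subst (+ (k * suc d) ℤ.<_) x≡ (ℤ.+<+ k[1+d]<n+dk+1))
  where
  k≤n = ≮⇒≥ (λ n<k → C≢0 (k>n⇒nCk≡0 n<k))
  k[1+d]<n+dk+1 : k * suc d < n + d * k + 1
  k[1+d]<n+dk+1 = begin-strict
    k * suc d         ≡⟨ *-suc k d ⟩
    k + k * d       ≡⟨ cong (_+_ k) (*-comm k d) ⟩
    k + d * k       ≤⟨ +-monoˡ-≤ (d * k) k≤n ⟩
    n + d * k       <⟨ m<m+n _ z<s ⟩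
    n + d * k + 1 ∎
    where open ≤-Reasoning
  x≡ : + (n + d * k + 1) ≡ x ℤ.- + d ℤ.- + 1 ℤ.+ + suc d
  x≡ = trans (cong (λ z → z ℤ.+ + (d * k) ℤ.+ + 1) (sym top≡)) (rearrange x (+ (d * k)) (+ d))
    where
    rearrange : ∀ x e d → x ℤ.- e ℤ.- + 1 ℤ.+ e ℤ.+ + 1 ≡ x ℤ.- d ℤ.- + 1 ℤ.+ (+ 1 ℤ.+ d)
    rearrange = ℤ-Solver.solve-∀

Cℤ-⊖-< : ∀ {m n} k → m < n → Cℤ (m ⊖ n) k ≡ 0
Cℤ-⊖-< {m} {n} k m<n rewrite ℤ.⊖-< m<n with n ∸ m | m<n⇒0<n∸m m<n
... | suc _ | _ = refl

Cℤ-⊖ : ∀ m n k → (k ≡ 0 → n ≤ m) → Cℤ (m ⊖ n) k ≡ (m ∸ n) C k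
Cℤ-⊖ m n k k≡0⇒n≤m with n ≤? m
... | yes n≤m rewrite ℤ.⊖-≥ n≤m = refl
Cℤ-⊖ m n zero    k≡0⇒n≤m | no n≰m = ⊥-elim (n≰m (k≡0⇒n≤m refl))
Cℤ-⊖ m n (suc k) _       | no n≰m =
  trans (Cℤ-⊖-< (suc k) (≰⇒> n≰m)) (sym (cong (_C suc k) (m≤n⇒m∸n≡0 (<⇒≤ (≰⇒> n≰m)))))

-- The two families

module _ {d s : ℕ} where

  smallCount : ℕ → ℕ
  smallCount k = Cℤ (+ s ℤ.+ + d ℤ.- + (d * k) ℤ.- + 1) k

  distinctCount≡smallCount : 1 ≤ s → ∀ k → distinctCount d (s ∸ 1) k ≡ smallCount k
  distinctCount≡smallCount 1≤s k = begin
    ((s ∸ 1 + d) ∸ d * k) C k    ≡⟨ cong (λ n → (n ∸ d * k) C k) (+-∸-comm d 1≤s) ⟨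
    ((s + d) ∸ 1 ∸ d * k) C k    ≡⟨ cong (_C k) (∸-+-assoc (s + d) 1 (d * k)) ⟩
    ((s + d) ∸ (1 + d * k)) C k  ≡⟨ cong (λ n → ((s + d) ∸ n) C k) (+-comm 1 (d * k)) ⟩
    ((s + d) ∸ (d * k + 1)) C k  ≡⟨ Cℤ-⊖ (s + d) (d * k + 1) k 1≤s+d ⟨
    Cℤ ((s + d) ⊖ (d * k + 1)) k ≡⟨ cong (λ z → Cℤ z k) (x-m-n≡⊖ (s + d) (d * k) 1) ⟨
    smallCount k                 ∎
    where
    open ≡-Reasoning
    1≤s+d : k ≡ 0 → d * k + 1 ≤ s + d
    1≤s+d refl = ≤-trans (≤-reflexive (cong (_+ 1) (*-zeroʳ d))) (≤-trans 1≤s (m≤m+n s d))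

  Small-count : 1 ≤ s → HasCount (λ λ′ → Σ ℕ λ k → DistinctChain d 1 (s ∸ 1) k λ′)
                                 (sumTo (ceilDiv (+ s ℤ.- + 1) (suc d)) smallCount)
  Small-count 1≤s = HasCount-sumTo count (λ (len , _) (len′ , _) → trans (sym len) len′) _ bounded
    where
    count : ∀ k → HasCount (DistinctChain d 1 (s ∸ 1) k) (smallCount k)
    count k = subst (HasCount _) (distinctCount≡smallCount 1≤s k) (DistinctChain-count 1 (s ∸ 1) k)
    bounded : ∀ {k λ′} → DistinctChain d 1 (s ∸ 1) k λ′ → + k ℤ.≤ ceilDiv (+ s ℤ.- + 1) (suc d)
    bounded {k} chain = subst (λ z → + k ℤ.≤ ceilDiv z (suc d)) (rearrange (+ s) (+ d))
                          (Cℤ≢0⇒≤ceilDiv (+ s ℤ.+ + d) d k (HasCount⇒≢0 (count k) chain))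
      where
      rearrange : ∀ s d → s ℤ.+ d ℤ.- d ℤ.- + 1 ≡ s ℤ.- + 1
      rearrange = ℤ-Solver.solve-∀

  TightPartition : ℕ → List ℕ → Set
  TightPartition c λ′ = All (0 <_) λ′ × DDistinct d λ′ × Tight s c λ′

  TightOfLength : ℕ → ℕ → List ℕ → Set
  TightOfLength c k λ′ = TightPartition c λ′ × length λ′ ≡ 2 + k

  tight⇒d<s : ∀ {c λ′} → TightPartition c λ′ → d < s
  tight⇒d<s {c} (_ , distinct , a , ρ , refl , corner) = +-cancelʳ-< c d s (begin-strict
    d + c                   ≤⟨ All.lookup (AllPairs.head (DDistinct⇒AllPairs distinct)) (∈-++⁺ʳ ρ (here refl)) ⟩
    a                       <⟨ m<m+n a (subst (0 <_) (sym (trans (length-++ ρ) (+-comm (length ρ) 1))) z<s) ⟩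
    a + length (ρ ++ [ c ]) ≡⟨ corner ⟩
    s + c                   ∎)
    where open ≤-Reasoning

  tightSlack : ℕ
  tightSlack = (s ∸ d) ∸ suc d

  tightFrom : ℕ → List ℕ → List ℕ
  tightFrom c ρ = withCorner (s + c) (ρ ++ [ c ])

  tightFrom-injective : ∀ {c ρ ρ′} → tightFrom c ρ ≡ tightFrom c ρ′ → ρ ≡ ρ′
  tightFrom-injective {ρ = ρ} {ρ′} eq = ∷ʳ-injectiveˡ ρ ρ′ (∷-injectiveʳ eq)

  semiperimeter-∷ʳ : ∀ x ρ {c} → semiperimeter ((x ∷ ρ) ++ [ c ]) ≡ suc (semiperimeter (x ∷ ρ))
  semiperimeter-∷ʳ x ρ =
    trans (cong (λ l → suc (x + l)) (trans (length-++ ρ) (+-comm (length ρ) 1))) (cong suc (+-suc x (length ρ)))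

  s+c≡d+c+[s∸d] : ∀ c → d ≤ s → s + c ≡ d + c + (s ∸ d)
  s+c≡d+c+[s∸d] c d≤s = trans (cong (_+ c) (sym (m+[n∸m]≡n d≤s))) (rearrange d (s ∸ d) c)
    where
    rearrange : ∀ d e c → d + e + c ≡ d + c + e
    rearrange = solve-∀

  DistinctChain⇒room : d < s → ∀ {c k} ρ → DistinctChain d (d + c) tightSlack k ρ →
                       semiperimeter (ρ ++ [ c ]) + d ≤ s + c
  DistinctChain⇒room d<s {c} [] _ = ≤-trans (≤-reflexive (rearrange c d)) (+-monoˡ-≤ c d<s)
    where
    rearrange : ∀ c d → suc (c + 0) + d ≡ suc d + c
    rearrange = solve-∀
  DistinctChain⇒room d<s {c} (x ∷ ρ) (_ , _ , bounded , sp≤) = begin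
    semiperimeter ((x ∷ ρ) ++ [ c ]) + d ≡⟨ cong (_+ d) (semiperimeter-∷ʳ x ρ) ⟩
    suc (semiperimeter (x ∷ ρ)) + d      ≡⟨ +-suc (semiperimeter (x ∷ ρ)) d ⟨
    semiperimeter (x ∷ ρ) + suc d        ≤⟨ m<x≤m+[n∸e]⇒x+e≤m+n (m<semiperimeter ρ bounded) sp≤ ⟩
    d + c + (s ∸ d)                      ≡⟨ s+c≡d+c+[s∸d] c (<⇒≤ d<s) ⟨
    s + c                                ∎
    where open ≤-Reasoning

  room⇒DistinctChain-bound : d < s → ∀ {c} ρ → semiperimeter (ρ ++ [ c ]) + d ≤ s + c →
                             semiperimeter ρ ≤ d + c + tightSlack
  room⇒DistinctChain-bound d<s     []      _    = z≤n
  room⇒DistinctChain-bound d<s {c} (x ∷ ρ) room = x+e≤m+n⇒x≤m+[n∸e] {e = suc d} {m = d + c} {n = s ∸ d} (begin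
    semiperimeter (x ∷ ρ) + suc d        ≡⟨ +-suc (semiperimeter (x ∷ ρ)) d ⟩
    suc (semiperimeter (x ∷ ρ)) + d      ≡⟨ cong (_+ d) (semiperimeter-∷ʳ x ρ) ⟨
    semiperimeter ((x ∷ ρ) ++ [ c ]) + d ≤⟨ room ⟩
    s + c                                ≡⟨ s+c≡d+c+[s∸d] c (<⇒≤ d<s) ⟩
    d + c + (s ∸ d)                      ∎)
    where open ≤-Reasoning

  tight-room : ∀ ρ {a c} → DDistinct d (a ∷ ρ ++ [ c ]) →
               semiperimeter (ρ ++ [ c ]) + d ≤ a + length (ρ ++ [ c ])
  tight-room []              (gap ∷ _) = semiperimeter-tail d [] gap
  tight-room (x ∷ ρ) {c = c} (gap ∷ _) = semiperimeter-tail d (ρ ++ [ c ]) gap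

  DistinctChain⇔TightOfLength : d < s → ∀ {c} → 1 ≤ c → ∀ k λ′ →
    (Σ (List ℕ) λ ρ → DistinctChain d (d + c) tightSlack k ρ × λ′ ≡ tightFrom c ρ) ⇔ TightOfLength c k λ′
  DistinctChain⇔TightOfLength d<s {c} 1≤c k λ′ = mk⇔ join split
    where
    join : _ → TightOfLength c k λ′
    join (ρ , chain@(len , distinct , bounded , _) , refl) =
      (positive , distinct′ , _ , ρ , refl , m∸n+n≡m len≤) ,
      cong suc (trans (length-++ ρ) (trans (cong (_+ 1) len) (+-comm k 1)))
      where
      room = DistinctChain⇒room d<s ρ chain
      len≤ : length (ρ ++ [ c ]) ≤ s + c
      len≤ = ≤-trans (length≤semiperimeter (ρ ++ [ c ])) (≤-trans (m≤m+n _ d) room)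
      distinct′ : DDistinct d (tightFrom c ρ)
      distinct′ = DDistinct-withCorner d (ρ ++ [ c ]) (DDistinct-∷ʳ⁺ ρ distinct bounded) room
      positive : All (0 <_) (tightFrom c ρ)
      positive = All.map (≤-trans 1≤c) (∷ʳ-lowerBound (_ ∷ ρ) (DDistinct⇒nonincreasing distinct′))
    split : TightOfLength c k λ′ → _
    split ((_ , distinct , a , ρ , refl , corner) , len) =
      ρ , (lenρ , distinctρ , boundedρ , room⇒DistinctChain-bound d<s ρ room) , cong (_∷ ρ ++ [ c ]) a≡
      where
      distinctρ = proj₁ (DDistinct-∷ʳ⁻ ρ (Linked.tail distinct))
      boundedρ  = proj₂ (DDistinct-∷ʳ⁻ ρ (Linked.tail distinct))
      room = ≤-trans (tight-room ρ distinct) (≤-reflexive corner)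
      a≡ : a ≡ s + c ∸ length (ρ ++ [ c ])
      a≡ = trans (sym (m+n∸n≡m a (length (ρ ++ [ c ])))) (cong (_∸ length (ρ ++ [ c ])) corner)
      lenρ : length ρ ≡ k
      lenρ = suc-injective (trans (+-comm 1 (length ρ)) (trans (sym (length-++ ρ)) (suc-injective len)))

  tightCount : ℕ → ℕ
  tightCount k = Cℤ (+ s ℤ.- + d ℤ.- + (d * k) ℤ.- + 1) k

  tightCount≡ : ∀ k → tightCount k ≡ Cℤ (s ⊖ (d + (d * k + 1))) k
  tightCount≡ k = cong (λ z → Cℤ z k) (trans (x-m-n≡x-[m+n] (+ s ℤ.- + d) (d * k) 1) (x-m-n≡⊖ s d (d * k + 1)))

  distinctCount≡tightCount : d < s → ∀ k → distinctCount d tightSlack k ≡ tightCount k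
  distinctCount≡tightCount d<s k = begin
    distinctCount d tightSlack k      ≡⟨ cong (λ n → distinctCount d n k) (∸-+-assoc (s ∸ d) 1 d) ⟨
    distinctCount d (s ∸ d ∸ 1 ∸ d) k ≡⟨ distinctCount-∸ {d} (s ∸ d ∸ 1) k ⟩
    (s ∸ d ∸ 1 ∸ d * k) C k           ≡⟨ cong (_C k) (∸-+-assoc (s ∸ d) 1 (d * k)) ⟩
    (s ∸ d ∸ (1 + d * k)) C k         ≡⟨ cong (_C k) (∸-+-assoc s d (1 + d * k)) ⟩
    (s ∸ (d + (1 + d * k))) C k       ≡⟨ cong (λ n → (s ∸ (d + n)) C k) (+-comm 1 (d * k)) ⟩
    (s ∸ (d + (d * k + 1))) C k       ≡⟨ Cℤ-⊖ s (d + (d * k + 1)) k d+1≤s ⟨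
    Cℤ (s ⊖ (d + (d * k + 1))) k      ≡⟨ tightCount≡ k ⟨
    tightCount k                      ∎
    where
    open ≡-Reasoning
    d+1≤s : k ≡ 0 → d + (d * k + 1) ≤ s
    d+1≤s refl = ≤-trans (≤-reflexive (trans (cong (λ n → d + (n + 1)) (*-zeroʳ d)) (+-comm d 1))) d<s

  TightOfLength-count : ∀ {c} → 1 ≤ c → ∀ k → HasCount (TightOfLength c k) (tightCount k)
  TightOfLength-count {c} 1≤c k with d <? s
  ... | yes d<s = subst (HasCount _) (distinctCount≡tightCount d<s k)
                    (HasCount-resp (DistinctChain⇔TightOfLength d<s 1≤c k)
                      (HasCount-image (tightFrom c) tightFrom-injective
                        (DistinctChain-count (d + c) tightSlack k)))
  ... | no d≮s = subst (HasCount _) (sym (trans (tightCount≡ k) (Cℤ-⊖-< k s<d+[dk+1])))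
                   (HasCount-∅ (λ _ (tight , _) → d≮s (tight⇒d<s tight)))
    where
    s<d+[dk+1] : s < d + (d * k + 1)
    s<d+[dk+1] = ≤-trans (s≤s (≮⇒≥ d≮s)) (≤-trans (≤-reflexive (+-comm 1 d)) (+-monoʳ-≤ d (m≤n+m 1 (d * k))))

  Tight-count : ∀ {c} → 1 ≤ c → HasCount (λ λ′ → Σ ℕ λ k → TightOfLength c k λ′)
                                         (sumTo (ceilDiv (+ s ℤ.- + (2 * d) ℤ.- + 1) (suc d)) tightCount)
  Tight-count {c} 1≤c = HasCount-sumTo (TightOfLength-count 1≤c) length-index _ bounded
    where
    length-index : ∀ {i j λ′} → TightOfLength c i λ′ → TightOfLength c j λ′ → i ≡ j
    length-index (_ , len) (_ , len′) = suc-injective (suc-injective (trans (sym len) len′))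
    bounded : ∀ {k λ′} → TightOfLength c k λ′ → + k ℤ.≤ ceilDiv (+ s ℤ.- + (2 * d) ℤ.- + 1) (suc d)
    bounded {k} tight = subst (λ z → + k ℤ.≤ ceilDiv z (suc d)) rearrange
                          (Cℤ≢0⇒≤ceilDiv (+ s ℤ.- + d) d k (HasCount⇒≢0 (TightOfLength-count 1≤c k) tight))
      where
      rearrange : + s ℤ.- + d ℤ.- + d ℤ.- + 1 ≡ + s ℤ.- + (2 * d) ℤ.- + 1
      rearrange = cong (ℤ._- + 1) (trans (x-m-n≡x-[m+n] (+ s) d d) (cong (λ n → + s ℤ.- + (d + n)) d≡d+0))
        where d≡d+0 = sym (+-identityʳ d)

module _ {d r s : ℕ} (1≤r : 1 ≤ r) (r≤d : r ≤ d) (1≤s : 1 ≤ s) where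

  Small Tights : List ℕ → Set
  Small  λ′ = Σ ℕ λ k → DistinctChain d 1 (s ∸ 1) k λ′
  Tights λ′ = Σ ℕ λ i → i < r ∸ 1 × Σ ℕ λ k → TightOfLength {d} {s} (suc i) k λ′

  Small⊎Tights⇔Counted : ∀ λ′ → (Small λ′ ⊎ Tights λ′) ⇔ Counted d r s λ′
  Small⊎Tights⇔Counted λ′ = mk⇔ sound complete
    where
    counted : All (0 <_) λ′ → DDistinct d λ′ → IsCore s λ′ × IsCore (s + r) λ′ → Counted d r s λ′
    counted positive distinct (core , core′) =
      (positive , DDistinct⇒nonincreasing distinct) , core , core′ , distinct
    sound : Small λ′ ⊎ Tights λ′ → Counted d r s λ′
    sound (inj₁ (_ , _ , distinct , positive , small)) =
      counted positive distinct (small⇒cores r≤d distinct (subst (semiperimeter λ′ ≤_) (m+[n∸m]≡n 1≤s) small))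
    sound (inj₂ (i , i<r∸1 , _ , (positive , distinct , tight) , _)) =
      counted positive distinct (tight⇒cores r≤d distinct (≤-trans (s≤s i<r∸1) (≤-reflexive (m+[n∸m]≡n 1≤r))) tight)
    complete : Counted d r s λ′ → Small λ′ ⊎ Tights λ′
    complete ((positive , _) , core , core′ , distinct)
      with cores⇒small-or-tight r≤d 1≤r 1≤s positive distinct core core′
    ... | inj₁ small =
      inj₁ (length λ′ , refl , distinct , positive , subst (semiperimeter λ′ ≤_) (sym (m+[n∸m]≡n 1≤s)) small)
    ... | inj₂ (zero  , _   , a , ρ , refl , _) =
      ⊥-elim (<-irrefl refl (All.lookup positive (there (∈-++⁺ʳ ρ (here refl)))))
    ... | inj₂ (suc i , c<r , tight@(a , ρ , refl , _)) =
      inj₂ (i , ∸-monoˡ-< c<r (s≤s z≤n) , length ρ , (positive , distinct , tight) ,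
            cong suc (trans (length-++ ρ) (+-comm (length ρ) 1)))

  Small-Tights-disjoint : ∀ {λ′} → Small λ′ → Tights λ′ → ⊥
  Small-Tights-disjoint (_ , _ , _ , _ , small) (i , _ , _ , (_ , _ , a , ρ , refl , corner) , _) =
    <-irrefl refl (begin-strict
      s                                  ≤⟨ m≤m+n s (suc i) ⟩
      s + suc i                          ≡⟨ corner ⟨
      a + length (ρ ++ [ suc i ])        <⟨ ≤-refl ⟩
      semiperimeter (a ∷ ρ ++ [ suc i ]) ≤⟨ small ⟩
      1 + (s ∸ 1)                        ≡⟨ m+[n∸m]≡n 1≤s ⟩
      s                                  ∎)
    where open ≤-Reasoning

  lastPart-index : ∀ {i j λ′} → (Σ ℕ λ k → TightOfLength {d} {s} (suc i) k λ′) →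
                   (Σ ℕ λ k → TightOfLength {d} {s} (suc j) k λ′) → i ≡ j
  lastPart-index (_ , (_ , _ , a , ρ , refl , _) , _) (_ , (_ , _ , a′ , ρ′ , eq , _) , _) =
    suc-injective (∷ʳ-injectiveʳ (a ∷ ρ) (a′ ∷ ρ′) eq)

theorem3p2 : (d r s : ℕ) → 1 ≤ r → r ≤ d → 1 ≤ s → HasCount (Counted d r s) (formula d r s)
theorem3p2 d r s 1≤r r≤d 1≤s =
  HasCount-resp (Small⊎Tights⇔Counted 1≤r r≤d 1≤s)
    (HasCount-⊎ (Small-Tights-disjoint 1≤r r≤d 1≤s) (Small-count 1≤s)
      (subst (HasCount _) (sum-map-const-upTo _ (r ∸ 1))
        (HasCount-Σ< (λ _ → Tight-count (s≤s z≤n)) (lastPart-index 1≤r r≤d 1≤s) (r ∸ 1))))
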